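{- Let $\mathcal{P}=(V,P)$ be a finite poset with $\dim(\mathcal{P})>1$, and let $G_\mathcal{P}$ be its underlying comparability graph. Then $\dim(\mathcal{P})\le 2\,\mathrm{box}(G_\mathcal{P})$.
   Context: A $k$-box is a Cartesian product of $k$ closed real intervals. The boxicity $\mathrm{box}(G)$ of a finite simple graph $G$ is the minimum integer $k$ such that vertices of $G$ can be mapped to $k$-boxes with two vertices adjacent iff their boxes intersect; the boxicity of a complete graph is $0$. Equivalently, for a non-complete graph it is the minimum number of interval graphs on $V(G)$ whose edge sets intersect to $E(G)$. A realizer of a poset $(S,P)$ is a set $\mathcal{R}$ of linear extensions of $P$ such that for distinct $x,y$, $x<y$ in $P$ iff $x<y$ in every $L\in\mathcal{R}$; the dimension $\dim(\mathcal{P})$ is the minimum size of a realizer. The underlying comparability graph $G_\mathcal{P}$ has vertex set $S$, with two distinct vertices adjacent iff they are comparable in $P$.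
   Formalization: The k-boxes defining the boxicity of $G_\mathcal{P}$ are products of closed intervals with rational endpoints rather than real ones. -}

module Defs where

open import Level using (0ℓ)
open import Data.Nat using (ℕ; _≤_)
open import Data.Fin using (Fin)
open import Data.Product using (Σ; _×_; proj₁; proj₂)
open import Data.Sum using (_⊎_)
open import Data.Rational as ℚ using (ℚ)
open import Relation.Nullary using (¬_)
open import Relation.Binary.PropositionalEquality using (_≡_; _≢_)
open import Relation.Binary.Structures using (IsPartialOrder; IsTotalOrder)
open import Function.Bundles using (_⇔_)

record Poset (n : ℕ) : Set₁ where
  field
    _⊑_       : Fin n → Fin n → Set
    isPartial : IsPartialOrder _≡_ _⊑_

record LinearExtension {n : ℕ} (P : Poset n) : Set₁ where
  field
    _≼_          : Fin n → Fin n → Set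
    isTotal      : IsTotalOrder _≡_ _≼_
    extends      : ∀ x y → Poset._⊑_ P x y → x ≼ y

IsRealizer : {n : ℕ} (P : Poset n) {m : ℕ} → (Fin m → LinearExtension P) → Set
IsRealizer {n} P {m} L =
  ∀ (x y : Fin n) → x ≢ y →
    Poset._⊑_ P x y ⇔ (∀ (i : Fin m) → LinearExtension._≼_ (L i) x y)

DimLe : {n : ℕ} → Poset n → ℕ → Set₁
DimLe P d = Σ ℕ λ m → m ≤ d × Σ (Fin m → LinearExtension P) λ L → IsRealizer P L

Graph : ℕ → Set₁
Graph n = Fin n → Fin n → Set

CompGraph : {n : ℕ} → Poset n → Graph n
CompGraph P x y = x ≢ y × (Poset._⊑_ P x y ⊎ Poset._⊑_ P y x)

record Interval : Set where
  constructor [_,_∣_]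
  field
    lo  : ℚ
    hi  : ℚ
    ord : lo ℚ.≤ hi

IntervalsMeet : Interval → Interval → Set
IntervalsMeet I J = Interval.lo I ℚ.≤ Interval.hi J × Interval.lo J ℚ.≤ Interval.hi I

Box : ℕ → Set
Box k = Fin k → Interval

BoxesMeet : {k : ℕ} → Box k → Box k → Set
BoxesMeet B C = ∀ j → IntervalsMeet (B j) (C j)

BoxRep : {n : ℕ} → Graph n → (k : ℕ) → (Fin n → Box k) → Set
BoxRep {n} G k f = ∀ (x y : Fin n) → x ≢ y → G x y ⇔ BoxesMeet (f x) (f y)

BoxLe : {n : ℕ} → Graph n → ℕ → Set
BoxLe G k = Σ (Fin _ → Box k) λ f → BoxRep G k f

-- Each coordinate j of a box representation yields two linear extensions of P:
-- one extending P by "the j-th interval of a lies entirely left of that of b",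
-- the other by "... entirely right of ...".  These additions are compatible with
-- P because comparable elements have meeting intervals.  If x and y are
-- incomparable their boxes miss each other in some coordinate j, and then one of
-- the two extensions for j puts y below x.  (Boxicity 0 makes P a chain, of
-- dimension 1.)  A finite decidable partial order is linearised by comparing the
-- binary numbers encoding its principal downsets.
module Submission where

open import Defs
open import Data.Nat using (ℕ; _*_)
open import Relation.Nullary using (¬_)

open import Level using (0ℓ)
open import Data.Nat using (zero; suc; _+_; _≤_; s≤s; z≤n)
open import Data.Nat.Properties
  using (*-monoʳ-≤; m≤n⇒m≤1+n; *-cancelˡ-≡; suc-injective; even≢odd;
         ≤-refl; ≤-reflexive; ≤-trans; ≤-antisym; ≤-total; +-identityʳ)
open import Data.Bool using (Bool; true; false; T)
open import Data.Unit using (tt)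
open import Data.Fin using (Fin; splitAt; _↑ˡ_; _↑ʳ_) renaming (zero to fzero; suc to fsuc)
open import Data.Fin.Properties using (all?; any?; ¬∀⟶∃¬; splitAt-↑ˡ; splitAt-↑ʳ) renaming (_≟_ to _≟ᶠ_)
open import Data.Product using (Σ; ∃; ∃₂; _×_; _,_; proj₁; proj₂)
open import Data.Sum using (_⊎_; inj₁; inj₂; [_,_]; fromInj₂)
open import Data.Empty using (⊥-elim)
import Data.Rational as ℚ
import Data.Rational.Properties as ℚ
open import Function using (_∘_; flip)
open import Function.Bundles using (mk⇔; Equivalence)
open import Relation.Nullary using (yes; no; contradiction)
open import Relation.Nullary.Decidable using (⌊_⌋; map′; toWitness; fromWitness; _×-dec_; _⊎-dec_)
open import Relation.Binary.Core using (Rel)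
open import Relation.Binary.Definitions using (Decidable; Total)
open import Relation.Binary.Structures using (IsPartialOrder; IsTotalOrder)
open import Relation.Binary.PropositionalEquality
  using (_≡_; _≢_; refl; sym; cong; subst; isEquivalence)

digit : Bool → ℕ → ℕ
digit false m = 2 * m
digit true  m = suc (2 * m)

digit-mono : ∀ {a b m n} → (T a → T b) → m ≤ n → digit a m ≤ digit b n
digit-mono {false} {false} _   m≤n = *-monoʳ-≤ 2 m≤n
digit-mono {false} {true}  _   m≤n = m≤n⇒m≤1+n (*-monoʳ-≤ 2 m≤n)
digit-mono {true}  {false} a⇒b _   = ⊥-elim (a⇒b tt)
digit-mono {true}  {true}  _   m≤n = s≤s (*-monoʳ-≤ 2 m≤n)

digit-injective : ∀ a b m n → digit a m ≡ digit b n → a ≡ b × m ≡ n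
digit-injective false false m n eq = refl , *-cancelˡ-≡ m n 2 eq
digit-injective true  true  m n eq = refl , *-cancelˡ-≡ m n 2 (suc-injective eq)
digit-injective false true  m n eq = ⊥-elim (even≢odd m n eq)
digit-injective true  false m n eq = ⊥-elim (even≢odd n m (sym eq))

binary : ∀ {n} → (Fin n → Bool) → ℕ
binary {zero}  _ = 0
binary {suc n} f = digit (f fzero) (binary (f ∘ fsuc))

binary-mono : ∀ {n} (f g : Fin n → Bool) → (∀ i → T (f i) → T (g i)) → binary f ≤ binary g
binary-mono {zero}  _ _ _   = z≤n
binary-mono {suc n} f g f⊆g =
  digit-mono (f⊆g fzero) (binary-mono (f ∘ fsuc) (g ∘ fsuc) (f⊆g ∘ fsuc))

binary-injective : ∀ {n} (f g : Fin n → Bool) → binary f ≡ binary g → ∀ i → f i ≡ g i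
binary-injective {suc n} f g eq fzero    = proj₁ (digit-injective (f fzero) (g fzero) _ _ eq)
binary-injective {suc n} f g eq (fsuc i) =
  binary-injective (f ∘ fsuc) (g ∘ fsuc) (proj₂ (digit-injective (f fzero) (g fzero) _ _ eq)) i

module Linearisation {n} {_⊑_ : Rel (Fin n) 0ℓ}
  (⊑-isPartialOrder : IsPartialOrder _≡_ _⊑_) (_⊑?_ : Decidable _⊑_) where

  open IsPartialOrder ⊑-isPartialOrder
    using () renaming (refl to ⊑-refl; trans to ⊑-trans; antisym to ⊑-antisym)

  downset : Fin n → Fin n → Bool
  downset x z = ⌊ z ⊑? x ⌋

  _≼_ : Rel (Fin n) 0ℓ
  x ≼ y = binary (downset x) ≤ binary (downset y)

  ⊑⇒≼ : ∀ {x y} → x ⊑ y → x ≼ y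
  ⊑⇒≼ {x} {y} x⊑y =
    binary-mono (downset x) (downset y) λ _ z⊑x → fromWitness (⊑-trans (toWitness z⊑x) x⊑y)

  downset-injective : ∀ {x y} → (∀ z → downset x z ≡ downset y z) → x ≡ y
  downset-injective {x} {y} eq = ⊑-antisym (below (eq x)) (below (sym (eq y)))
    where
    below : ∀ {u v} → downset u u ≡ downset v u → u ⊑ v
    below {u} {v} e = toWitness {a? = u ⊑? v} (subst T e (fromWitness {a? = u ⊑? u} ⊑-refl))

  ≼-isTotalOrder : IsTotalOrder _≡_ _≼_
  ≼-isTotalOrder = record
    { isPartialOrder = record
      { isPreorder = record
        { isEquivalence = isEquivalence
        ; reflexive     = λ { refl → ≤-refl }
        ; trans         = ≤-trans
        }
      ; antisym = λ x≼y y≼x → downset-injective (binary-injective _ _ (≤-antisym x≼y y≼x))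
      }
    ; total = λ x y → ≤-total (binary (downset x)) (binary (downset y))
    }

module Precedence {n} {_⊑_ _≺_ : Rel (Fin n) 0ℓ}
  (⊑-isPartialOrder : IsPartialOrder _≡_ _⊑_) (_⊑?_ : Decidable _⊑_) (_≺?_ : Decidable _≺_)
  (≺-⊑-≺ : ∀ {a b c d} → a ≺ b → b ⊑ c → c ≺ d → a ≺ d)
  (≺⇒⋣ : ∀ {a b} → a ≺ b → ¬ b ⊑ a) where

  open IsPartialOrder ⊑-isPartialOrder
    using () renaming (refl to ⊑-refl; trans to ⊑-trans; antisym to ⊑-antisym)

  _⊏_ : Rel (Fin n) 0ℓ
  x ⊏ y = ∃₂ λ a b → x ⊑ a × a ≺ b × b ⊑ y

  ⊑-⊏-trans : ∀ {x y z} → x ⊑ y → y ⊏ z → x ⊏ z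
  ⊑-⊏-trans x⊑y (a , b , y⊑a , a≺b , b⊑z) = a , b , ⊑-trans x⊑y y⊑a , a≺b , b⊑z

  ⊏-⊑-trans : ∀ {x y z} → x ⊏ y → y ⊑ z → x ⊏ z
  ⊏-⊑-trans (a , b , x⊑a , a≺b , b⊑y) y⊑z = a , b , x⊑a , a≺b , ⊑-trans b⊑y y⊑z

  ⊏-trans : ∀ {x y z} → x ⊏ y → y ⊏ z → x ⊏ z
  ⊏-trans (a , b , x⊑a , a≺b , b⊑y) (c , d , y⊑c , c≺d , d⊑z) =
    a , d , x⊑a , ≺-⊑-≺ a≺b (⊑-trans b⊑y y⊑c) c≺d , d⊑z

  ⊏-irrefl : ∀ {x} → ¬ x ⊏ x
  ⊏-irrefl (_ , _ , x⊑a , a≺b , b⊑x) = ≺⇒⋣ a≺b (⊑-trans b⊑x x⊑a)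

  _⊴_ : Rel (Fin n) 0ℓ
  x ⊴ y = x ⊑ y ⊎ x ⊏ y

  _⊴?_ : Decidable _⊴_
  x ⊴? y = (x ⊑? y) ⊎-dec any? λ a → any? λ b → (x ⊑? a) ×-dec (a ≺? b) ×-dec (b ⊑? y)

  ⊴-trans : ∀ {x y z} → x ⊴ y → y ⊴ z → x ⊴ z
  ⊴-trans (inj₁ x⊑y) (inj₁ y⊑z) = inj₁ (⊑-trans x⊑y y⊑z)
  ⊴-trans (inj₁ x⊑y) (inj₂ y⊏z) = inj₂ (⊑-⊏-trans x⊑y y⊏z)
  ⊴-trans (inj₂ x⊏y) (inj₁ y⊑z) = inj₂ (⊏-⊑-trans x⊏y y⊑z)
  ⊴-trans (inj₂ x⊏y) (inj₂ y⊏z) = inj₂ (⊏-trans x⊏y y⊏z)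

  ⊴-antisym : ∀ {x y} → x ⊴ y → y ⊴ x → x ≡ y
  ⊴-antisym (inj₁ x⊑y) (inj₁ y⊑x) = ⊑-antisym x⊑y y⊑x
  ⊴-antisym (inj₁ x⊑y) (inj₂ y⊏x) = contradiction (⊏-⊑-trans y⊏x x⊑y) ⊏-irrefl
  ⊴-antisym (inj₂ x⊏y) (inj₁ y⊑x) = contradiction (⊏-⊑-trans x⊏y y⊑x) ⊏-irrefl
  ⊴-antisym (inj₂ x⊏y) (inj₂ y⊏x) = contradiction (⊏-trans x⊏y y⊏x) ⊏-irrefl

  ⊴-isPartialOrder : IsPartialOrder _≡_ _⊴_
  ⊴-isPartialOrder = record
    { isPreorder = record
      { isEquivalence = isEquivalence
      ; reflexive     = λ { refl → inj₁ ⊑-refl }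
      ; trans         = ⊴-trans
      }
    ; antisym = ⊴-antisym
    }

  open Linearisation ⊴-isPartialOrder _⊴?_ public using (_≼_; ≼-isTotalOrder)

  ⊑⇒≼ : ∀ {x y} → x ⊑ y → x ≼ y
  ⊑⇒≼ = Linearisation.⊑⇒≼ ⊴-isPartialOrder _⊴?_ ∘ inj₁

  ≺⇒≼ : ∀ {x y} → x ≺ y → x ≼ y
  ≺⇒≼ x≺y = Linearisation.⊑⇒≼ ⊴-isPartialOrder _⊴?_ (inj₂ (_ , _ , ⊑-refl , x≺y , ⊑-refl))

_≼⟨_⟩_ : ∀ {n} {P : Poset n} → Fin n → LinearExtension P → Fin n → Set
x ≼⟨ E ⟩ y = LinearExtension._≼_ E x y

module _ {n} (P : Poset n) where

  open Poset P

  linearExtension-containing : {_≺_ : Rel (Fin n) 0ℓ} → Decidable _⊑_ → Decidable _≺_ →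
    (∀ {a b c d} → a ≺ b → b ⊑ c → c ≺ d → a ≺ d) → (∀ {a b} → a ≺ b → ¬ b ⊑ a) →
    Σ (LinearExtension P) λ E → ∀ {x y} → x ≺ y → x ≼⟨ E ⟩ y
  linearExtension-containing _⊑?_ _≺?_ ≺-⊑-≺ ≺⇒⋣ =
    record { _≼_ = _≼_ ; isTotal = ≼-isTotalOrder ; extends = λ _ _ → ⊑⇒≼ } , ≺⇒≼
    where open Precedence isPartial _⊑?_ _≺?_ ≺-⊑-≺ ≺⇒⋣

  realizer-if-reversing : Decidable _⊑_ → ∀ {m} (L : Fin m → LinearExtension P) →
    (∀ x y → x ≢ y → ¬ x ⊑ y → ∃ λ i → y ≼⟨ L i ⟩ x) → IsRealizer P L
  realizer-if-reversing _⊑?_ L reverses x y x≢y =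
    mk⇔ (λ x⊑y i → LinearExtension.extends (L i) x y x⊑y) ≼-everywhere⇒⊑
    where
    ≼-everywhere⇒⊑ : (∀ i → x ≼⟨ L i ⟩ y) → x ⊑ y
    ≼-everywhere⇒⊑ x≼y with x ⊑? y
    ... | yes x⊑y = x⊑y
    ... | no x⋢y  = let i , y≼x = reverses x y x≢y x⋢y in
      contradiction (IsTotalOrder.antisym (LinearExtension.isTotal (L i)) (x≼y i) y≼x) x≢y

  total⇒dimLe1 : Decidable _⊑_ → Total _⊑_ → DimLe P 1
  total⇒dimLe1 _⊑?_ total =
    1 , ≤-refl , (λ _ → P-itself) , realizer-if-reversing _⊑?_ (λ _ → P-itself) reverse
    where
    P-itself : LinearExtension P
    P-itself = record
      { _≼_     = _⊑_
      ; isTotal = record { isPartialOrder = isPartial ; total = total }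
      ; extends = λ _ _ x⊑y → x⊑y
      }
    reverse : ∀ x y → x ≢ y → ¬ x ⊑ y → ∃ λ (i : Fin 1) → y ⊑ x
    reverse x y _ x⋢y = fzero , fromInj₂ (flip contradiction x⋢y) (total x y)

record Before (I J : Interval) : Set where
  constructor before
  field hi<lo : Interval.hi I ℚ.< Interval.lo J

before? : Decidable Before
before? I J = map′ before Before.hi<lo (Interval.hi I ℚ.<? Interval.lo J)

intervalsMeet? : Decidable IntervalsMeet
intervalsMeet? I J = (Interval.lo I ℚ.≤? Interval.hi J) ×-dec (Interval.lo J ℚ.≤? Interval.hi I)

boxesMeet? : ∀ {k} → Decidable (BoxesMeet {k})
boxesMeet? B C = all? λ j → intervalsMeet? (B j) (C j)

intervalsMeet-refl : ∀ I → IntervalsMeet I I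
intervalsMeet-refl I = Interval.ord I , Interval.ord I

intervalsMeet-sym : ∀ {I J} → IntervalsMeet I J → IntervalsMeet J I
intervalsMeet-sym (lo≤hi , lo≤hi′) = lo≤hi′ , lo≤hi

before⇒¬meet : ∀ {I J} → Before I J → ¬ IntervalsMeet I J
before⇒¬meet (before hiI<loJ) (_ , loJ≤hiI) = ℚ.<-irrefl refl (ℚ.<-≤-trans hiI<loJ loJ≤hiI)

before-meet-before : ∀ {I J K L} → Before I J → IntervalsMeet J K → Before K L → Before I L
before-meet-before (before hiI<loJ) (loJ≤hiK , _) (before hiK<loL) =
  before (ℚ.<-trans (ℚ.<-≤-trans hiI<loJ loJ≤hiK) hiK<loL)

¬meet⇒before : ∀ {I J} → ¬ IntervalsMeet I J → Before I J ⊎ Before J I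
¬meet⇒before {I} {J} ¬meet with Interval.lo I ℚ.≤? Interval.hi J
... | no loI≰hiJ = inj₂ (before (ℚ.≰⇒> loI≰hiJ))
... | yes loI≤hiJ with Interval.lo J ℚ.≤? Interval.hi I
...   | yes loJ≤hiI = contradiction (loI≤hiJ , loJ≤hiI) ¬meet
...   | no loJ≰hiI  = inj₁ (before (ℚ.≰⇒> loJ≰hiI))

module BoxRepresentation {n} (P : Poset n) {k} (f : Fin n → Box k)
  (rep : BoxRep (CompGraph P) k f) where

  open Poset P
  open IsPartialOrder isPartial using () renaming (refl to ⊑-refl; antisym to ⊑-antisym)

  ⊑⇒boxesMeet : ∀ {x y} → x ⊑ y → BoxesMeet (f x) (f y)
  ⊑⇒boxesMeet {x} {y} x⊑y with x ≟ᶠ y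
  ... | yes refl = λ j → intervalsMeet-refl (f x j)
  ... | no x≢y   = Equivalence.to (rep x y x≢y) (x≢y , inj₁ x⊑y)

  ⊒⇒intervalsMeet : ∀ {x y} → y ⊑ x → ∀ j → IntervalsMeet (f x j) (f y j)
  ⊒⇒intervalsMeet {x} {y} y⊑x j = intervalsMeet-sym {f y j} {f x j} (⊑⇒boxesMeet y⊑x j)

  boxesMeet⇒comparable : ∀ {x y} → x ≢ y → BoxesMeet (f x) (f y) → x ⊑ y ⊎ y ⊑ x
  boxesMeet⇒comparable {x} {y} x≢y meet = proj₂ (Equivalence.from (rep x y x≢y) meet)

  _⊑?_ : Decidable _⊑_
  x ⊑? y with x ≟ᶠ y
  ... | yes refl = yes ⊑-refl
  ... | no x≢y with boxesMeet? (f x) (f y)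
  ...   | no ¬meet = no (¬meet ∘ ⊑⇒boxesMeet)
  ...   | yes meet =
    [ yes , (λ y⊑x → no λ x⊑y → x≢y (⊑-antisym x⊑y y⊑x)) ] (boxesMeet⇒comparable x≢y meet)

  total-if-allBoxesMeet : (∀ x y → BoxesMeet (f x) (f y)) → Total _⊑_
  total-if-allBoxesMeet meet x y with x ≟ᶠ y
  ... | yes refl = inj₁ ⊑-refl
  ... | no x≢y   = boxesMeet⇒comparable x≢y (meet x y)

  _≺[_]_ : Fin n → Fin k → Fin n → Set
  x ≺[ j ] y = Before (f x j) (f y j)

  leftToRight : (j : Fin k) → Σ (LinearExtension P) λ E → ∀ {x y} → x ≺[ j ] y → x ≼⟨ E ⟩ y
  leftToRight j =
    linearExtension-containing P {λ x y → x ≺[ j ] y} _⊑?_ (λ x y → before? (f x j) (f y j))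
      (λ a≺b b⊑c c≺d → before-meet-before a≺b (⊑⇒boxesMeet b⊑c j) c≺d)
      (λ a≺b b⊑a → before⇒¬meet a≺b (⊒⇒intervalsMeet b⊑a j))

  rightToLeft : (j : Fin k) → Σ (LinearExtension P) λ E → ∀ {x y} → y ≺[ j ] x → x ≼⟨ E ⟩ y
  rightToLeft j =
    linearExtension-containing P {λ x y → y ≺[ j ] x} _⊑?_ (λ x y → before? (f y j) (f x j))
      (λ b≺a b⊑c d≺c → before-meet-before d≺c (⊒⇒intervalsMeet b⊑c j) b≺a)
      (λ b≺a b⊑a → before⇒¬meet b≺a (⊑⇒boxesMeet b⊑a j))

  extensions : Fin (k + k) → LinearExtension P
  extensions i = [ proj₁ ∘ leftToRight , proj₁ ∘ rightToLeft ] (splitAt k i)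

  ≺⇒≼-leftToRight : ∀ j {x y} → x ≺[ j ] y → x ≼⟨ extensions (j ↑ˡ k) ⟩ y
  ≺⇒≼-leftToRight j rewrite splitAt-↑ˡ k j k = proj₂ (leftToRight j)

  ≻⇒≼-rightToLeft : ∀ j {x y} → y ≺[ j ] x → x ≼⟨ extensions (k ↑ʳ j) ⟩ y
  ≻⇒≼-rightToLeft j rewrite splitAt-↑ʳ k k j = proj₂ (rightToLeft j)

  extensions-reverse : Fin k → ∀ x y → x ≢ y → ¬ x ⊑ y → ∃ λ i → y ≼⟨ extensions i ⟩ x
  extensions-reverse j₀ x y x≢y x⋢y with boxesMeet? (f x) (f y)
  ... | yes meet = j₀ ↑ˡ k , LinearExtension.extends (extensions (j₀ ↑ˡ k)) y x
    (fromInj₂ (flip contradiction x⋢y) (boxesMeet⇒comparable x≢y meet))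
  ... | no ¬meet with ¬∀⟶∃¬ k _ (λ j → intervalsMeet? (f x j) (f y j)) ¬meet
  ...   | j , ¬meetⱼ =
    [ (λ x≺y → k ↑ʳ j , ≻⇒≼-rightToLeft j x≺y) , (λ y≺x → j ↑ˡ k , ≺⇒≼-leftToRight j y≺x) ]
      (¬meet⇒before ¬meetⱼ)

theorem1 : (n : ℕ) (P : Poset n) → ¬ DimLe P 1 →
    ∀ (k : ℕ) → BoxLe (CompGraph P) k → DimLe P (2 * k)
theorem1 n P dim≰1 zero (f , rep) =
  contradiction (total⇒dimLe1 P _⊑?_ (total-if-allBoxesMeet λ _ _ ())) dim≰1
  where open BoxRepresentation P f rep
theorem1 n P _ k@(suc _) (f , rep) =
  k + k , ≤-reflexive (cong (k +_) (sym (+-identityʳ k))) ,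
  extensions , realizer-if-reversing P _⊑?_ extensions (extensions-reverse fzero)
  where open BoxRepresentation P f rep
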